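{- Fix integers $l\ge2$ and $k\ge1$. Let $Z(M,N)$ be the weighted number of paths from $(0,0)$ to $(M,N)$ in the model with only elementary steps and filters of type 1 at $x=lk-1$ and $x=l(k+2)-1$ (no wall), and let $Z'(M,N)$ be the weighted number of paths from $(0,0)$ to $(M,N)$ in the same model augmented by the long steps $\mathbb{S}(k)$ (see context). Then for every lattice point $(M,N)$ with $lk-1\le M\le l(k+2)-2$: (i) if $N\le M+2l-2$, then $Z'(M,N)=Z(M,N)$; (ii) if $M+2l\le N\le l(k+4)-2$, then $Z'(M,N)=Z(M,N)+Z(M+2l,N)$.
   Context: Lattice: $\mathcal{L}=\{(x,y)\in\mathbb{Z}^2: x+y\equiv 0 \pmod 2\}$. A lattice path model is given by a set of allowed steps $(x,y)\to(x',y+1)$ between lattice points, each with a positive weight. A path from $(0,0)$ to $(M,N)$ is a sequence $P_0=(0,0),\dots,P_N=(M,N)$ of lattice points with each $P_i\to P_{i+1}$ allowed; its weight is the product of step weights; the weighted number of paths is the sum of weights of all such paths ($0$ if none). Filter of type 1 at $x=d$: from $(d,y)$ the only step is $(d,y)\to(d+1,y+1)$, weight $1$; from $(d+1,y)$ the only steps are $(d+1,y)\to(d+2,y+1)$ with weight $1$ and $(d+1,y)\to(d,y+1)$ with weight $2$. In the model for $Z$, the filters are at $d=lk-1$ and $d=l(k+2)-1$, and from every other point $(x,y)$ (including $x<0$) the steps are $(x,y)\to(x\pm1,y+1)$, weight $1$. Long steps $\mathbb{S}(k)$: $(l(k+2)-2,\,lk-2+2m)\to(lk-1,\,lk-1+2m)$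 for all integers $m\ge0$, each of weight $1$, added to the steps already allowed. -}

module Defs where

open import Data.Bool using (Bool; true; false; if_then_else_; _∧_)
open import Data.Nat as ℕ using (ℕ; zero; suc; _≤ᵇ_; _≡ᵇ_; _%_; _∸_)
open import Data.Integer as ℤ using (ℤ; +_; -[1+_]; _+_; _-_; 1ℤ)
open import Relation.Nullary.Decidable using (⌊_⌋)

filterA : ℕ → ℕ → ℤ
filterA l k = + (l ℕ.* k) - 1ℤ

filterB : ℕ → ℕ → ℤ
filterB l k = + (l ℕ.* (k ℕ.+ 2)) - 1ℤ

infix 4 _==_
_==_ : ℤ → ℤ → Bool
x == y = ⌊ x ℤ.≟ y ⌋

-- Weight of the elementary step (x,y) → (x',y+1) in the model for Z
-- (0 if the step is not allowed).
-- Filters of type 1 at d = a and d = b; ordinary steps x → x±1 elsewhere.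
stepW : ℕ → ℕ → ℤ → ℤ → ℕ
stepW l k x x' =
  if x == d₁ then (if x' == (d₁ + 1ℤ) then 1 else 0) else
  if x == (d₁ + 1ℤ) then (if x' == (d₁ + + 2) then 1 else if x' == d₁ then 2 else 0) else
  if x == d₂ then (if x' == (d₂ + 1ℤ) then 1 else 0) else
  if x == (d₂ + 1ℤ) then (if x' == (d₂ + + 2) then 1 else if x' == d₂ then 2 else 0) else
  (if x' == (x + 1ℤ) then 1 else if x' == (x - 1ℤ) then 1 else 0)
  where
  d₁ = filterA l k
  d₂ = filterB l k

-- Weight of the long step (l(k+2)-2, y) → (lk-1, y+1) of S(k):
-- present (weight 1) iff y = lk-2+2m for some m ≥ 0.
longW : ℕ → ℕ → ℕ → ℕ
longW l k y =
  if ((l ℕ.* k ∸ 2) ≤ᵇ y) ∧ ((y ∸ (l ℕ.* k ∸ 2)) % 2 ≡ᵇ 0) then 1 else 0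

-- W withLong l k y x = weighted number of paths from (0,0) to (x,y)
-- (y ≥ 0), with long steps S(k) included iff withLong = true.
W : Bool → ℕ → ℕ → ℕ → ℤ → ℕ
W long l k zero x = if x == + 0 then 1 else 0
W long l k (suc y) x =
  stepW l k (x - 1ℤ) x ℕ.* W long l k y (x - 1ℤ)
  ℕ.+ stepW l k (x + 1ℤ) x ℕ.* W long l k y (x + 1ℤ)
  ℕ.+ (if long ∧ (x == filterA l k)
         then longW l k y ℕ.* W long l k y (filterB l k - 1ℤ)
         else 0)

Zgen : Bool → ℕ → ℕ → ℤ → ℤ → ℕ
Zgen long l k M (+ n) = W long l k n M
Zgen long l k M -[1+ n ] = 0

Z : ℕ → ℕ → ℤ → ℤ → ℕ
Z = Zgen false

Z' : ℕ → ℕ → ℤ → ℤ → ℕ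
Z' = Zgen true

{-# OPTIONS --safe #-}

-- Write a = lk-1 and b = l(k+2)-1 = a+2l for the two filters.  Translation by 2l carries the
-- filter at a onto the filter at b, so for a ≤ x < b the recursions for Z at x and at x+2l use
-- the same step weights.  Induction on the height gives Z'(x,y) = Z(x,y) + Z(x+2l,y) on this
-- strip: at x = a the long step brings in Z(b-1,y), exactly what the step b-1 → b brings into
-- Z(b,y+1) (by parity, the long step exists whenever (b-1,y) is reachable); at x = b-1 nothing
-- enters from the filter at b, while (b+2l,y) is still out of reach; left of a, Z' = Z since no
-- path crosses the filter at a leftwards.  The induction holds as long as (b-1+2l,y) is out of
-- reach, i.e. for y ≤ l(k+4)-2, and part (i) is the case where (M+2l,N) is out of reach.

module Submission where

open import Defs
open import Data.Nat as ℕ using (ℕ)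
open import Data.Integer as ℤ using (ℤ; +_; _+_; _-_; 1ℤ)
open import Data.Integer.Divisibility using (_∣_)
open import Data.Product using (_×_)
open import Relation.Binary.PropositionalEquality using (_≡_)

import Algebra.Properties.CommutativeSemigroup as CommutativeSemigroupProperties
open import Data.Bool using (Bool; true; false; if_then_else_; _∧_; T)
open import Data.Integer using (-_; -[1+_])
import Data.Integer.Properties as ℤP
open import Data.Integer.Tactic.RingSolver using (solve-∀)
open import Data.Nat using (zero; suc; z≤n; s≤s)
open import Data.Nat.DivMod using (_/_; m≡m%n+[m/n]*n; m%n<n)
import Data.Nat.Properties as ℕP
import Data.Nat.Tactic.RingSolver as ℕSolver
open import Data.Product using (_,_)
open import Data.Sum using (_⊎_; inj₁; inj₂; [_,_]′)
open import Data.Unit using (tt)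
open import Function using (_∘_)
open import Relation.Binary.PropositionalEquality
  using (_≢_; refl; sym; trans; cong; cong₂; subst; subst₂; module ≡-Reasoning)
open import Relation.Nullary using (yes; no; contradiction)
open import Relation.Nullary.Decidable using (isYes≗does; dec-true; dec-false)

open import Algebra.Properties.AbelianGroup ℤP.+-0-abelianGroup using (∙-cancelˡ; ∙-cancelʳ)
module ℕ+ = CommutativeSemigroupProperties ℕP.+-commutativeSemigroup
module ℤ+ = CommutativeSemigroupProperties ℤP.+-commutativeSemigroup

==-true : ∀ {x y} → x ≡ y → (x == y) ≡ true
==-true {x} {y} x≡y = trans (isYes≗does (x ℤ.≟ y)) (dec-true (x ℤ.≟ y) x≡y)

==-false : ∀ {x y} → x ≢ y → (x == y) ≡ false
==-false {x} {y} x≢y = trans (isYes≗does (x ℤ.≟ y)) (dec-false (x ℤ.≟ y) x≢y)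

==-+ʳ : ∀ x y z → (x + z == y + z) ≡ (x == y)
==-+ʳ x y z with x ℤ.≟ y
... | yes x≡y = ==-true (cong (_+ z) x≡y)
... | no  x≢y = ==-false (x≢y ∘ ∙-cancelʳ z x y)

==-+-shift : ∀ x′ x t z → (x′ + z == (x + z) + t) ≡ (x′ == x + t)
==-+-shift x′ x t z = trans (cong (x′ + z ==_) (ℤ+.xy∙z≈xz∙y x z t)) (==-+ʳ x′ (x + t) z)

x-1≢x+1 : ∀ x → x - 1ℤ ≢ x + 1ℤ
x-1≢x+1 x e with ∙-cancelˡ x (- 1ℤ) 1ℤ e
... | ()

x+1≢x : ∀ x → x + 1ℤ ≢ x
x+1≢x x e with ∙-cancelˡ x 1ℤ (+ 0) (trans e (sym (ℤP.+-identityʳ x)))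
... | ()

odd≢0 : ∀ j → j + j + 1ℤ ≢ + 0
odd≢0 (+ n)    e with trans (ℕP.+-comm 1 (n ℕ.+ n)) (ℤP.+-injective e)
... | ()
odd≢0 -[1+ n ] ()

*-≡0ʳ : ∀ m {n} → n ≡ 0 → m ℕ.* n ≡ 0
*-≡0ʳ m n≡0 = trans (cong (m ℕ.*_) n≡0) (ℕP.*-zeroʳ m)

≤-2⇒≤ : ∀ {n m t} → t ≡ 2 ℕ.+ m → + n ℤ.≤ + t - + 2 → n ℕ.≤ m
≤-2⇒≤ refl = ℤP.drop‿+≤+

elementaryW : ℤ → ℤ → ℕ
elementaryW x x′ = if x′ == x + 1ℤ then 1 else if x′ == x - 1ℤ then 1 else 0

elementaryW-+ : ∀ x x′ z → elementaryW (x + z) (x′ + z) ≡ elementaryW x x′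
elementaryW-+ x x′ z =
  cong₂ (λ t u → if t then 1 else if u then 1 else 0) (==-+-shift x′ x 1ℤ z) (==-+-shift x′ x (- 1ℤ) z)

module Model (l k : ℕ) where

  a b : ℤ
  a = filterA l k
  b = filterB l k

  C : ℕ
  C = 2 ℕ.* l

  c : ℤ
  c = + C

  step : ℤ → ℤ → ℕ
  step = stepW l k

  w w′ : ℕ → ℤ → ℕ
  w  = W false l k
  w′ = W true l k

  P : ℕ → ℤ
  P i = a + + i

  P-injective : ∀ {i j} → P i ≡ P j → i ≡ j
  P-injective {i} {j} e = ℤP.+-injective (∙-cancelˡ a (+ i) (+ j) e)

  ≢-by-offset : ∀ {x y i j} → x ≡ P i → y ≡ P j → i ≢ j → x ≢ y
  ≢-by-offset x≡Pi y≡Pj i≢j x≡y = i≢j (P-injective (trans (sym x≡Pi) (trans x≡y y≡Pj)))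

  P-suc : ∀ i → P i + 1ℤ ≡ P (suc i)
  P-suc i = trans (ℤP.+-assoc a (+ i) 1ℤ) (cong (λ t → a + t) (trans (ℤP.+-comm (+ i) 1ℤ) (sym (ℤP.pos-+ 1 i))))

  P-pred : ∀ i → P (suc i) - 1ℤ ≡ P i
  P-pred i = trans (cong (_- 1ℤ) (sym (P-suc i))) (+1-1 (P i))
    where
    +1-1 : ∀ x → x + 1ℤ - 1ℤ ≡ x
    +1-1 = solve-∀

  P-+c : ∀ i → P i + c ≡ P (i ℕ.+ C)
  P-+c i = trans (ℤP.+-assoc a (+ i) c) (cong (λ t → a + t) (sym (ℤP.pos-+ i C)))

  a≡P0 : a ≡ P 0
  a≡P0 = sym (ℤP.+-identityʳ a)

  P∣x-a∣≡x : ∀ {x} → a ℤ.≤ x → P ℤ.∣ x - a ∣ ≡ x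
  P∣x-a∣≡x {x} a≤x =
    trans (cong (λ t → a + t) (ℤP.0≤i⇒+∣i∣≡i (ℤP.i≤j⇒0≤j-i a≤x))) (a+[x-a]≡x a x)
    where
    a+[x-a]≡x : ∀ a x → a + (x - a) ≡ x
    a+[x-a]≡x = solve-∀

  b≡a+c : b ≡ a + c
  b≡a+c = begin
    + (l ℕ.* (k ℕ.+ 2)) - 1ℤ     ≡⟨ cong (λ n → + n - 1ℤ) lk+2≡lk+C ⟩
    + (l ℕ.* k ℕ.+ C) - 1ℤ       ≡⟨ cong (_- 1ℤ) (ℤP.pos-+ (l ℕ.* k) C) ⟩
    + (l ℕ.* k) + c - 1ℤ         ≡⟨ ℤ+.xy∙z≈xz∙y (+ (l ℕ.* k)) c (- 1ℤ) ⟩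
    a + c                        ∎
    where
    open ≡-Reasoning
    lk+2≡lk+C : l ℕ.* (k ℕ.+ 2) ≡ l ℕ.* k ℕ.+ C
    lk+2≡lk+C = trans (ℕP.*-distribˡ-+ l k 2) (cong (l ℕ.* k ℕ.+_) (ℕP.*-comm l 2))

  a+1≡P1 : a + 1ℤ ≡ P 1
  a+1≡P1 = trans (cong (_+ 1ℤ) a≡P0) (P-suc 0)

  b≡PC : b ≡ P C
  b≡PC = trans b≡a+c (trans (cong (_+ c) a≡P0) (P-+c 0))

  b+1≡P[1+C] : b + 1ℤ ≡ P (suc C)
  b+1≡P[1+C] = trans (cong (_+ 1ℤ) b≡PC) (P-suc C)

  stepW-a : ∀ x′ → step a x′ ≡ (if x′ == a + 1ℤ then 1 else 0)
  stepW-a x′ rewrite ==-true {a} refl = refl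

  stepW-a+1 : ∀ x′ → step (a + 1ℤ) x′ ≡ (if x′ == a + + 2 then 1 else if x′ == a then 2 else 0)
  stepW-a+1 x′ rewrite ==-false (x+1≢x a) | ==-true {a + 1ℤ} refl = refl

  stepW-b : b ≢ a → b ≢ a + 1ℤ → ∀ x′ → step b x′ ≡ (if x′ == b + 1ℤ then 1 else 0)
  stepW-b b≢a b≢a+1 x′ rewrite ==-false b≢a | ==-false b≢a+1 | ==-true {b} refl = refl

  stepW-b+1 : b + 1ℤ ≢ a → b + 1ℤ ≢ a + 1ℤ → ∀ x′ →
              step (b + 1ℤ) x′ ≡ (if x′ == b + + 2 then 1 else if x′ == b then 2 else 0)
  stepW-b+1 ≢a ≢a+1 x′
    rewrite ==-false ≢a | ==-false ≢a+1 | ==-false (x+1≢x b) | ==-true {b + 1ℤ} refl = refl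

  stepW-elementary : ∀ {x} → x ≢ a → x ≢ a + 1ℤ → x ≢ b → x ≢ b + 1ℤ →
                     ∀ x′ → step x x′ ≡ elementaryW x x′
  stepW-elementary ≢a ≢a+1 ≢b ≢b+1 x′
    rewrite ==-false ≢a | ==-false ≢a+1 | ==-false ≢b | ==-false ≢b+1 = refl

  inflowˡ inflowʳ : Bool → ℕ → ℤ → ℕ
  inflowˡ long y x = step (x - 1ℤ) x ℕ.* W long l k y (x - 1ℤ)
                     ℕ.+ (if long ∧ (x == a) then longW l k y ℕ.* W long l k y (b - 1ℤ) else 0)
  inflowʳ long y x = step (x + 1ℤ) x ℕ.* W long l k y (x + 1ℤ)

  W-suc : ∀ long y x → W long l k (suc y) x ≡ inflowˡ long y x ℕ.+ inflowʳ long y x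
  W-suc long y x = ℕ+.xy∙z≈xz∙y (step (x - 1ℤ) x ℕ.* W long l k y (x - 1ℤ)) (inflowʳ long y x) _

  inflowˡ-false : ∀ y x → inflowˡ false y x ≡ step (x - 1ℤ) x ℕ.* w y (x - 1ℤ)
  inflowˡ-false y x = ℕP.+-identityʳ _

  inflowˡ-true-≢a : ∀ y {x} → x ≢ a → inflowˡ true y x ≡ step (x - 1ℤ) x ℕ.* w′ y (x - 1ℤ)
  inflowˡ-true-≢a y x≢a rewrite ==-false x≢a = ℕP.+-identityʳ _

  inflowˡ-true-a : ∀ y →
    inflowˡ true y a ≡ step (a - 1ℤ) a ℕ.* w′ y (a - 1ℤ) ℕ.+ longW l k y ℕ.* w′ y (b - 1ℤ)
  inflowˡ-true-a y rewrite ==-true {a} refl = refl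

  w-out-of-reach : ∀ {y m} → y ℕ.< m → w y (+ m) ≡ 0
  w-out-of-reach {zero}  {suc m} _          = refl
  w-out-of-reach {suc y} {suc m} (s≤s y<m) = begin
    w (suc y) (+ suc m)                                     ≡⟨ W-suc false y (+ suc m) ⟩
    inflowˡ false y (+ suc m) ℕ.+ inflowʳ false y (+ suc m) ≡⟨ cong₂ ℕ._+_ from-left from-right ⟩
    0 ℕ.+ 0                                                 ∎
    where
    open ≡-Reasoning
    from-left : inflowˡ false y (+ suc m) ≡ 0
    from-left = trans (ℕP.+-identityʳ _) (*-≡0ʳ (step (+ m) (+ suc m)) (w-out-of-reach y<m))
    from-right : inflowʳ false y (+ suc m) ≡ 0
    from-right = *-≡0ʳ (step (+ suc m + 1ℤ) (+ suc m))
      (trans (cong (λ n → w y (+ n)) (ℕP.+-comm (suc m) 1)) (w-out-of-reach (ℕP.m<n⇒m<1+n (ℕP.m<n⇒m<1+n y<m))))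

  w-odd : ∀ y x j → x + + y ≡ j + j + 1ℤ → w y x ≡ 0
  w-odd zero    x j x≡odd = cong (λ t → if t then 1 else 0) (==-false x≢0)
    where
    x≢0 : x ≢ + 0
    x≢0 refl = odd≢0 j (sym x≡odd)
  w-odd (suc y) x j x+y≡odd = begin
    w (suc y) x                                 ≡⟨ W-suc false y x ⟩
    inflowˡ false y x ℕ.+ inflowʳ false y x     ≡⟨ cong₂ ℕ._+_ from-left from-right ⟩
    0 ℕ.+ 0                                     ∎
    where
    open ≡-Reasoning
    x+[1+y]≡odd : x + (1ℤ + + y) ≡ j + j + 1ℤ
    x+[1+y]≡odd = trans (cong (λ t → x + t) (sym (ℤP.pos-+ 1 y))) x+y≡odd
    shift-left : ∀ x y j → x + (1ℤ + y) ≡ j + j + 1ℤ → (x - 1ℤ) + y ≡ (j - 1ℤ) + (j - 1ℤ) + 1ℤ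
    shift-left x y j e = trans (ring₁ x y) (trans (cong (_- + 2) e) (ring₂ j))
      where
      ring₁ : ∀ x y → (x - 1ℤ) + y ≡ x + (1ℤ + y) - + 2
      ring₁ = solve-∀
      ring₂ : ∀ j → j + j + 1ℤ - + 2 ≡ (j - 1ℤ) + (j - 1ℤ) + 1ℤ
      ring₂ = solve-∀
    shift-right : ∀ x y → (x + 1ℤ) + y ≡ x + (1ℤ + y)
    shift-right = solve-∀
    from-left : inflowˡ false y x ≡ 0
    from-left = trans (ℕP.+-identityʳ _)
      (*-≡0ʳ (step (x - 1ℤ) x) (w-odd y (x - 1ℤ) (j - 1ℤ) (shift-left x (+ y) j x+[1+y]≡odd)))
    from-right : inflowʳ false y x ≡ 0
    from-right =
      *-≡0ʳ (step (x + 1ℤ) x) (w-odd y (x + 1ℤ) j (trans (shift-right x (+ y)) x+[1+y]≡odd))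

  P⁻ : ℕ → ℤ
  P⁻ j = a - + suc j

  P⁻-pred : ∀ j → P⁻ j - 1ℤ ≡ P⁻ (suc j)
  P⁻-pred j = trans (ring a (+ suc j)) (cong (λ t → a - t) (sym (ℤP.pos-+ 1 (suc j))))
    where
    ring : ∀ a t → a - t - 1ℤ ≡ a - (1ℤ + t)
    ring = solve-∀

  P⁻-suc : ∀ j → P⁻ (suc j) + 1ℤ ≡ P⁻ j
  P⁻-suc j = trans (cong (λ t → a - t + 1ℤ) (ℤP.pos-+ 1 (suc j))) (ring a (+ suc j))
    where
    ring : ∀ a t → a - (1ℤ + t) + 1ℤ ≡ a - t
    ring = solve-∀

  P⁻≢a : ∀ j → P⁻ j ≢ a
  P⁻≢a j e with ∙-cancelˡ a (- + suc j) (+ 0) (trans e (sym (ℤP.+-identityʳ a)))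
  ... | ()

  w′≡w-left-of-a : ∀ y j → w′ y (P⁻ j) ≡ w y (P⁻ j)
  w′≡w-left-of-a zero    j = refl
  w′≡w-left-of-a (suc y) j = begin
    w′ (suc y) (P⁻ j)                                  ≡⟨ W-suc true y (P⁻ j) ⟩
    inflowˡ true y (P⁻ j) ℕ.+ inflowʳ true y (P⁻ j)    ≡⟨ cong₂ ℕ._+_ from-left (from-right j) ⟩
    inflowˡ false y (P⁻ j) ℕ.+ inflowʳ false y (P⁻ j)  ≡⟨ sym (W-suc false y (P⁻ j)) ⟩
    w (suc y) (P⁻ j)                                   ∎
    where
    open ≡-Reasoning
    from-left : inflowˡ true y (P⁻ j) ≡ inflowˡ false y (P⁻ j)
    from-left = begin
      inflowˡ true y (P⁻ j)                                    ≡⟨ inflowˡ-true-≢a y (P⁻≢a j) ⟩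
      step (P⁻ j - 1ℤ) (P⁻ j) ℕ.* w′ y (P⁻ j - 1ℤ)             ≡⟨ cong (step (P⁻ j - 1ℤ) (P⁻ j) ℕ.*_) agree ⟩
      step (P⁻ j - 1ℤ) (P⁻ j) ℕ.* w y (P⁻ j - 1ℤ)              ≡⟨ inflowˡ-false y (P⁻ j) ⟨
      inflowˡ false y (P⁻ j)                                   ∎
      where
      agree : w′ y (P⁻ j - 1ℤ) ≡ w y (P⁻ j - 1ℤ)
      agree = subst (λ u → w′ y u ≡ w y u) (sym (P⁻-pred j)) (w′≡w-left-of-a y (suc j))
    from-right : ∀ j → inflowʳ true y (P⁻ j) ≡ inflowʳ false y (P⁻ j)
    from-right zero = trans (cong (ℕ._* w′ y (P⁻ 0 + 1ℤ)) a↛a-1) (sym (cong (ℕ._* w y (P⁻ 0 + 1ℤ)) a↛a-1))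
      where
      x-1+1≡x : ∀ x → x - 1ℤ + 1ℤ ≡ x
      x-1+1≡x = solve-∀
      a↛a-1 : step (P⁻ 0 + 1ℤ) (P⁻ 0) ≡ 0
      a↛a-1 = trans (cong (λ u → step u (P⁻ 0)) (x-1+1≡x a))
                (trans (stepW-a (a - 1ℤ)) (cong (λ t → if t then 1 else 0) (==-false (x-1≢x+1 a))))
    from-right (suc j) = cong (step (P⁻ (suc j) + 1ℤ) (P⁻ (suc j)) ℕ.*_)
      (subst (λ u → w′ y u ≡ w y u) (sym (P⁻-suc j)) (w′≡w-left-of-a y j))

  module Strip (2≤l : 2 ℕ.≤ l) (1≤k : 1 ℕ.≤ k) where

    p : ℕ
    p = l ℕ.* k ℕ.∸ 2

    lk≡2+p : l ℕ.* k ≡ 2 ℕ.+ p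
    lk≡2+p = sym (ℕP.m+[n∸m]≡n (ℕP.*-mono-≤ 2≤l 1≤k))

    C₁ : ℕ
    C₁ = C ℕ.∸ 1

    4≤C : 4 ℕ.≤ C
    4≤C = ℕP.*-monoʳ-≤ 2 2≤l

    C≢0 : C ≢ 0
    C≢0 = ℕP.>⇒≢ (ℕP.≤-trans (s≤s z≤n) 4≤C)

    C≢1 : C ≢ 1
    C≢1 = ℕP.>⇒≢ (ℕP.≤-trans (s≤s (s≤s z≤n)) 4≤C)

    C≡1+C₁ : C ≡ suc C₁
    C≡1+C₁ = sym (ℕP.m+[n∸m]≡n (ℕP.≤-trans (s≤s z≤n) 4≤C))

    C₁<C : C₁ ℕ.< C
    C₁<C = ℕP.≤-reflexive (sym C≡1+C₁)

    P≡+ : ∀ i → P i ≡ + (suc p ℕ.+ i)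
    P≡+ i = cong (λ n → + n - 1ℤ + + i) lk≡2+p

    P+c-out-of-reach : ∀ {y} i → y ℕ.< suc p ℕ.+ (i ℕ.+ C) → w y (P i + c) ≡ 0
    P+c-out-of-reach {y} i y< = trans (cong (w y) (trans (P-+c i) (P≡+ (i ℕ.+ C)))) (w-out-of-reach y<)

    P-elementary : ∀ {i} → 2 ℕ.≤ i → i ℕ.< C ⊎ suc (suc C) ℕ.≤ i →
                   ∀ x′ → step (P i) x′ ≡ elementaryW (P i) x′
    P-elementary {i} 2≤i i∉[C,1+C] = stepW-elementary
      (≢-by-offset refl a≡P0 (ℕP.>⇒≢ (ℕP.≤-trans (s≤s z≤n) 2≤i)))
      (≢-by-offset refl a+1≡P1 (ℕP.>⇒≢ 2≤i))
      (≢-by-offset refl b≡PC i≢C)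
      (≢-by-offset refl b+1≡P[1+C] i≢1+C)
      where
      i≢C : i ≢ C
      i≢C = [ ℕP.<⇒≢ , ℕP.>⇒≢ ∘ ℕP.<⇒≤ ]′ i∉[C,1+C]
      i≢1+C : i ≢ suc C
      i≢1+C = [ ℕP.<⇒≢ ∘ ℕP.m<n⇒m<1+n , ℕP.>⇒≢ ]′ i∉[C,1+C]

    b≢a : b ≢ a
    b≢a = ≢-by-offset b≡PC a≡P0 C≢0

    b≢a+1 : b ≢ a + 1ℤ
    b≢a+1 = ≢-by-offset b≡PC a+1≡P1 C≢1

    b+1≢a : b + 1ℤ ≢ a
    b+1≢a = ≢-by-offset b+1≡P[1+C] a≡P0 λ ()

    b+1≢a+1 : b + 1ℤ ≢ a + 1ℤ
    b+1≢a+1 = ≢-by-offset b+1≡P[1+C] a+1≡P1 (C≢0 ∘ ℕP.suc-injective)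

    ==-b+ : ∀ x′ t → (x′ + c == b + t) ≡ (x′ == a + t)
    ==-b+ x′ t = trans (cong (λ u → x′ + c == u + t) b≡a+c) (==-+-shift x′ a t c)

    ==-b : ∀ x′ → (x′ + c == b) ≡ (x′ == a)
    ==-b x′ = trans (cong (x′ + c ==_) b≡a+c) (==-+ʳ x′ a c)

    P0+c≡b : P 0 + c ≡ b
    P0+c≡b = trans (cong (_+ c) (sym a≡P0)) (sym b≡a+c)

    stepW-+c : ∀ {i} → i ℕ.< C → ∀ x′ → step (P i + c) (x′ + c) ≡ step (P i) x′
    stepW-+c {zero} _ x′ = begin
      step (P 0 + c) (x′ + c)                ≡⟨ cong (λ u → step u (x′ + c)) P0+c≡b ⟩
      step b (x′ + c)                        ≡⟨ stepW-b b≢a b≢a+1 (x′ + c) ⟩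
      (if x′ + c == b + 1ℤ then 1 else 0)    ≡⟨ cong (λ t → if t then 1 else 0) (==-b+ x′ 1ℤ) ⟩
      (if x′ == a + 1ℤ then 1 else 0)        ≡⟨ sym (stepW-a x′) ⟩
      step a x′                              ≡⟨ cong (λ u → step u x′) a≡P0 ⟩
      step (P 0) x′                          ∎
      where open ≡-Reasoning
    stepW-+c {suc zero} _ x′ = begin
      step (P 1 + c) (x′ + c)                ≡⟨ cong (λ u → step u (x′ + c)) (trans (P-+c 1) (sym b+1≡P[1+C])) ⟩
      step (b + 1ℤ) (x′ + c)                 ≡⟨ stepW-b+1 b+1≢a b+1≢a+1 (x′ + c) ⟩
      (if x′ + c == b + + 2 then 1 else if x′ + c == b then 2 else 0)
        ≡⟨ cong₂ (λ t u → if t then 1 else if u then 2 else 0) (==-b+ x′ (+ 2)) (==-b x′) ⟩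
      (if x′ == a + + 2 then 1 else if x′ == a then 2 else 0)
        ≡⟨ sym (stepW-a+1 x′) ⟩
      step (a + 1ℤ) x′                       ≡⟨ cong (λ u → step u x′) a+1≡P1 ⟩
      step (P 1) x′                          ∎
      where open ≡-Reasoning
    stepW-+c {i@(suc (suc _))} i<C x′ = begin
      step (P i + c) (x′ + c)                ≡⟨ cong (λ u → step u (x′ + c)) (P-+c i) ⟩
      step (P (i ℕ.+ C)) (x′ + c)            ≡⟨ P-elementary 2≤i+C (inj₂ (ℕP.+-monoˡ-≤ C 2≤i)) (x′ + c) ⟩
      elementaryW (P (i ℕ.+ C)) (x′ + c)     ≡⟨ cong (λ u → elementaryW u (x′ + c)) (sym (P-+c i)) ⟩
      elementaryW (P i + c) (x′ + c)         ≡⟨ elementaryW-+ (P i) x′ c ⟩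
      elementaryW (P i) x′                   ≡⟨ sym (P-elementary 2≤i (inj₁ i<C) x′) ⟩
      step (P i) x′                          ∎
      where
      open ≡-Reasoning
      2≤i : 2 ℕ.≤ i
      2≤i = s≤s (s≤s z≤n)
      2≤i+C : 2 ℕ.≤ i ℕ.+ C
      2≤i+C = ℕP.≤-trans 2≤i (ℕP.m≤m+n i C)

    b-1≡PC₁ : b - 1ℤ ≡ P C₁
    b-1≡PC₁ = trans (cong (_- 1ℤ) (trans b≡PC (cong P C≡1+C₁))) (P-pred C₁)

    b-1≡+[p+C] : b - 1ℤ ≡ + (p ℕ.+ C)
    b-1≡+[p+C] = trans b-1≡PC₁ (trans (P≡+ C₁) (cong +_ 1+p+C₁≡p+C))
      where
      1+p+C₁≡p+C : suc p ℕ.+ C₁ ≡ p ℕ.+ C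
      1+p+C₁≡p+C = trans (sym (ℕP.+-suc p C₁)) (cong (p ℕ.+_) (sym C≡1+C₁))

    b-1↝b : step (b - 1ℤ) b ≡ 1
    b-1↝b = begin
      step (b - 1ℤ) b         ≡⟨ cong (λ u → step u b) b-1≡PC₁ ⟩
      step (P C₁) b           ≡⟨ P-elementary 2≤C₁ (inj₁ C₁<C) b ⟩
      elementaryW (P C₁) b    ≡⟨ cong (λ t → if t then 1 else if b == P C₁ - 1ℤ then 1 else 0) (==-true b≡PC₁+1) ⟩
      1                       ∎
      where
      open ≡-Reasoning
      2≤C₁ : 2 ℕ.≤ C₁
      2≤C₁ = ℕP.≤-trans (ℕP.n≤1+n 2) (ℕ.s≤s⁻¹ (subst (4 ℕ.≤_) C≡1+C₁ 4≤C))
      b≡PC₁+1 : b ≡ P C₁ + 1ℤ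
      b≡PC₁+1 = trans b≡PC (trans (cong P C≡1+C₁) (sym (P-suc C₁)))

    b↛b-1 : step b (b - 1ℤ) ≡ 0
    b↛b-1 = trans (stepW-b b≢a b≢a+1 (b - 1ℤ)) (cong (λ t → if t then 1 else 0) (==-false (x-1≢x+1 b)))

    w[b-1]-below : ∀ {y} → y ℕ.< p → w y (b - 1ℤ) ≡ 0
    w[b-1]-below {y} y<p = trans (cong (w y) b-1≡+[p+C]) (w-out-of-reach (ℕP.<-≤-trans y<p (ℕP.m≤m+n p C)))

    w[b-1]-odd : ∀ q → w (p ℕ.+ suc (q ℕ.* 2)) (b - 1ℤ) ≡ 0
    w[b-1]-odd q = w-odd y (b - 1ℤ) (+ j) (trans (cong (_+ + y) b-1≡+[p+C]) (cong +_ (sum-odd p q l)))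
      where
      y j : ℕ
      y = p ℕ.+ suc (q ℕ.* 2)
      j = p ℕ.+ q ℕ.+ l
      sum-odd : ∀ p q l →
        p ℕ.+ 2 ℕ.* l ℕ.+ (p ℕ.+ suc (q ℕ.* 2)) ≡ (p ℕ.+ q ℕ.+ l) ℕ.+ (p ℕ.+ q ℕ.+ l) ℕ.+ 1
      sum-odd = ℕSolver.solve-∀

    longW*w[b-1]≡w[b-1] : ∀ y → longW l k y ℕ.* w y (b - 1ℤ) ≡ w y (b - 1ℤ)
    longW*w[b-1]≡w[b-1] y with p ℕ.≤ᵇ y in p≤ᵇy
    ... | false = sym (w[b-1]-below (ℕP.≰⇒> (λ p≤y → subst T p≤ᵇy (ℕP.≤⇒≤ᵇ p≤y))))
    ... | true with (y ℕ.∸ p) ℕ.% 2 in [y-p]%2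
    ...   | 0           = ℕP.*-identityˡ _
    ...   | 1           = sym (subst (λ n → w n (b - 1ℤ) ≡ 0) (sym y≡p+1+2q) (w[b-1]-odd q))
      where
      q : ℕ
      q = (y ℕ.∸ p) / 2
      y≡p+1+2q : y ≡ p ℕ.+ suc (q ℕ.* 2)
      y≡p+1+2q = begin
        y                                      ≡⟨ ℕP.m+[n∸m]≡n (ℕP.≤ᵇ⇒≤ p y (subst T (sym p≤ᵇy) tt)) ⟨
        p ℕ.+ (y ℕ.∸ p)                        ≡⟨ cong (p ℕ.+_) (m≡m%n+[m/n]*n (y ℕ.∸ p) 2) ⟩
        p ℕ.+ ((y ℕ.∸ p) ℕ.% 2 ℕ.+ q ℕ.* 2)    ≡⟨ cong (λ r → p ℕ.+ (r ℕ.+ q ℕ.* 2)) [y-p]%2 ⟩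
        p ℕ.+ suc (q ℕ.* 2)                    ∎
        where open ≡-Reasoning
    ...   | suc (suc r) = contradiction (subst (ℕ._< 2) [y-p]%2 (m%n<n (y ℕ.∸ p) 2)) λ { (s≤s (s≤s ())) }

    StripIdentity : ℕ → Set
    StripIdentity y = ∀ i → i ℕ.< C → w′ y (P i) ≡ w y (P i) ℕ.+ w y (P i + c)

    w′[b-1]≡w[b-1] : ∀ {y} → y ℕ.< p ℕ.+ C ℕ.+ C → StripIdentity y → w′ y (b - 1ℤ) ≡ w y (b - 1ℤ)
    w′[b-1]≡w[b-1] {y} y< IH = begin
      w′ y (b - 1ℤ)                   ≡⟨ cong (w′ y) b-1≡PC₁ ⟩
      w′ y (P C₁)                     ≡⟨ IH C₁ C₁<C ⟩
      w y (P C₁) ℕ.+ w y (P C₁ + c)   ≡⟨ cong (w y (P C₁) ℕ.+_) (P+c-out-of-reach C₁ (subst (y ℕ.<_) reach y<)) ⟩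
      w y (P C₁) ℕ.+ 0                ≡⟨ ℕP.+-identityʳ _ ⟩
      w y (P C₁)                      ≡⟨ cong (w y) b-1≡PC₁ ⟨
      w y (b - 1ℤ)                    ∎
      where
      open ≡-Reasoning
      reach : p ℕ.+ C ℕ.+ C ≡ suc p ℕ.+ (C₁ ℕ.+ C)
      reach = trans (ℕP.+-assoc p C C)
                    (trans (cong (λ n → p ℕ.+ (n ℕ.+ C)) C≡1+C₁) (ℕP.+-suc p (C₁ ℕ.+ C)))

    neighbour-split : ∀ {y} → StripIdentity y → ∀ {u} j → j ℕ.< C → u ≡ P j → ∀ x →
      step u x ℕ.* w′ y u ≡ step u x ℕ.* w y u ℕ.+ step (u + c) (x + c) ℕ.* w y (u + c)
    neighbour-split {y} IH j j<C refl x = begin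
      step (P j) x ℕ.* w′ y (P j)                                   ≡⟨ cong (step (P j) x ℕ.*_) (IH j j<C) ⟩
      step (P j) x ℕ.* (w y (P j) ℕ.+ w y (P j + c))                ≡⟨ ℕP.*-distribˡ-+ (step (P j) x) _ _ ⟩
      step (P j) x ℕ.* w y (P j) ℕ.+ step (P j) x ℕ.* w y (P j + c)
        ≡⟨ cong (λ s → step (P j) x ℕ.* w y (P j) ℕ.+ s ℕ.* w y (P j + c)) (stepW-+c j<C x) ⟨
      step (P j) x ℕ.* w y (P j) ℕ.+ step (P j + c) (x + c) ℕ.* w y (P j + c) ∎
      where open ≡-Reasoning

    inflowˡ-split-at-a : ∀ {y} → y ℕ.< p ℕ.+ C ℕ.+ C → StripIdentity y →
                         inflowˡ true y a ≡ inflowˡ false y a ℕ.+ inflowˡ false y b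
    inflowˡ-split-at-a {y} y< IH = begin
      inflowˡ true y a
        ≡⟨ inflowˡ-true-a y ⟩
      step (a - 1ℤ) a ℕ.* w′ y (a - 1ℤ) ℕ.+ longW l k y ℕ.* w′ y (b - 1ℤ)
        ≡⟨ cong₂ ℕ._+_ (cong (step (a - 1ℤ) a ℕ.*_) (w′≡w-left-of-a y 0))
                       (cong (longW l k y ℕ.*_) (w′[b-1]≡w[b-1] y< IH)) ⟩
      step (a - 1ℤ) a ℕ.* w y (a - 1ℤ) ℕ.+ longW l k y ℕ.* w y (b - 1ℤ)
        ≡⟨ cong (step (a - 1ℤ) a ℕ.* w y (a - 1ℤ) ℕ.+_) (longW*w[b-1]≡w[b-1] y) ⟩
      step (a - 1ℤ) a ℕ.* w y (a - 1ℤ) ℕ.+ w y (b - 1ℤ)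
        ≡⟨ cong₂ ℕ._+_ (inflowˡ-false y a) (trans (inflowˡ-false y b) elementary-into-b) ⟨
      inflowˡ false y a ℕ.+ inflowˡ false y b
        ∎
      where
      open ≡-Reasoning
      elementary-into-b : step (b - 1ℤ) b ℕ.* w y (b - 1ℤ) ≡ w y (b - 1ℤ)
      elementary-into-b = trans (cong (ℕ._* w y (b - 1ℤ)) b-1↝b) (ℕP.*-identityˡ _)

    inflowˡ-split : ∀ {y} → y ℕ.< p ℕ.+ C ℕ.+ C → StripIdentity y → ∀ {i} → i ℕ.< C →
                    inflowˡ true y (P i) ≡ inflowˡ false y (P i) ℕ.+ inflowˡ false y (P i + c)
    inflowˡ-split {y} y< IH {zero} _ =
      subst₂ (λ u v → inflowˡ true y u ≡ inflowˡ false y u ℕ.+ inflowˡ false y v)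
             a≡P0 (sym P0+c≡b) (inflowˡ-split-at-a y< IH)
    inflowˡ-split {y} _ IH {suc j} 1+j<C = begin
      inflowˡ true y x                                     ≡⟨ inflowˡ-true-≢a y x≢a ⟩
      step (x - 1ℤ) x ℕ.* w′ y (x - 1ℤ)                    ≡⟨ neighbour-split {y} IH j j<C (P-pred j) x ⟩
      step (x - 1ℤ) x ℕ.* w y (x - 1ℤ) ℕ.+ step (x - 1ℤ + c) (x + c) ℕ.* w y (x - 1ℤ + c)
        ≡⟨ cong₂ ℕ._+_ (inflowˡ-false y x) shifted ⟨
      inflowˡ false y x ℕ.+ inflowˡ false y (x + c)        ∎
      where
      open ≡-Reasoning
      x : ℤ
      x = P (suc j)
      x≢a : x ≢ a
      x≢a = ≢-by-offset refl a≡P0 λ ()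
      j<C : j ℕ.< C
      j<C = ℕP.<-trans (ℕP.n<1+n j) 1+j<C
      shifted : inflowˡ false y (x + c) ≡ step (x - 1ℤ + c) (x + c) ℕ.* w y (x - 1ℤ + c)
      shifted = trans (inflowˡ-false y (x + c))
                      (cong (λ u → step u (x + c) ℕ.* w y u) (ℤ+.xy∙z≈xz∙y x c (- 1ℤ)))

    inflowʳ-split : ∀ {y} → y ℕ.< p ℕ.+ C ℕ.+ C → StripIdentity y → ∀ {i} → i ℕ.< C →
                    inflowʳ true y (P i) ≡ inflowʳ false y (P i) ℕ.+ inflowʳ false y (P i + c)
    inflowʳ-split {y} y< IH {i} i<C with ℕP.m≤n⇒m<n∨m≡n i<C
    ... | inj₁ 1+i<C = begin
      inflowʳ true y x                                     ≡⟨ neighbour-split {y} IH (suc i) 1+i<C (P-suc i) x ⟩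
      inflowʳ false y x ℕ.+ step (x + 1ℤ + c) (x + c) ℕ.* w y (x + 1ℤ + c)
        ≡⟨ cong (λ u → inflowʳ false y x ℕ.+ step u (x + c) ℕ.* w y u) (ℤ+.xy∙z≈xz∙y x c 1ℤ) ⟨
      inflowʳ false y x ℕ.+ inflowʳ false y (x + c)        ∎
      where
      open ≡-Reasoning
      x : ℤ
      x = P i
    ... | inj₂ 1+i≡C = begin
      inflowʳ true y x                                     ≡⟨ cong (ℕ._* w′ y (x + 1ℤ)) b↛x ⟩
      0 ℕ.+ 0                                              ≡⟨ cong₂ ℕ._+_ (cong (ℕ._* w y (x + 1ℤ)) b↛x) shifted ⟨
      inflowʳ false y x ℕ.+ inflowʳ false y (x + c)        ∎
      where
      open ≡-Reasoning
      x : ℤ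
      x = P i
      P[1+i]≡b : P (suc i) ≡ b
      P[1+i]≡b = trans (cong P 1+i≡C) (sym b≡PC)
      x+1≡b : x + 1ℤ ≡ b
      x+1≡b = trans (P-suc i) P[1+i]≡b
      b↛x : step (x + 1ℤ) x ≡ 0
      b↛x = trans (cong₂ step x+1≡b (trans (sym (P-pred i)) (cong (_- 1ℤ) P[1+i]≡b))) b↛b-1
      shifted : inflowʳ false y (x + c) ≡ 0
      shifted = *-≡0ʳ (step (x + c + 1ℤ) (x + c))
        (trans (cong (w y) (trans (ℤ+.xy∙z≈xz∙y x c 1ℤ) (cong (_+ c) (trans x+1≡b b≡PC))))
               (P+c-out-of-reach C (ℕP.m<n⇒m<1+n (subst (y ℕ.<_) (ℕP.+-assoc p C C) y<))))

    strip-identity : ∀ y → y ℕ.≤ p ℕ.+ C ℕ.+ C → StripIdentity y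
    strip-identity zero    _ i _ =
      sym (trans (cong (w 0 (P i) ℕ.+_) (P+c-out-of-reach i (s≤s z≤n))) (ℕP.+-identityʳ _))
    strip-identity (suc y) y< i i<C = begin
      w′ (suc y) x
        ≡⟨ W-suc true y x ⟩
      inflowˡ true y x ℕ.+ inflowʳ true y x
        ≡⟨ cong₂ ℕ._+_ (inflowˡ-split y< IH i<C) (inflowʳ-split y< IH i<C) ⟩
      (inflowˡ false y x ℕ.+ inflowˡ false y (x + c)) ℕ.+ (inflowʳ false y x ℕ.+ inflowʳ false y (x + c))
        ≡⟨ ℕ+.interchange (inflowˡ false y x) _ _ _ ⟩
      (inflowˡ false y x ℕ.+ inflowʳ false y x) ℕ.+ (inflowˡ false y (x + c) ℕ.+ inflowʳ false y (x + c))
        ≡⟨ cong₂ ℕ._+_ (W-suc false y x) (W-suc false y (x + c)) ⟨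
      w (suc y) x ℕ.+ w (suc y) (x + c)
        ∎
      where
      open ≡-Reasoning
      x : ℤ
      x = P i
      IH : StripIdentity y
      IH = strip-identity y (ℕP.<⇒≤ y<)

    l[k+2]≡2+[p+C] : l ℕ.* (k ℕ.+ 2) ≡ 2 ℕ.+ (p ℕ.+ C)
    l[k+2]≡2+[p+C] = trans (ℕP.*-distribˡ-+ l k 2) (cong₂ ℕ._+_ lk≡2+p (ℕP.*-comm l 2))

    l[k+4]≡2+[p+C+C] : l ℕ.* (k ℕ.+ 4) ≡ 2 ℕ.+ (p ℕ.+ C ℕ.+ C)
    l[k+4]≡2+[p+C+C] = trans (ℕP.*-distribˡ-+ l k 4)
      (trans (cong₂ ℕ._+_ lk≡2+p (l4≡2l+2l l)) (cong (2 ℕ.+_) (sym (ℕP.+-assoc p C C))))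
      where
      l4≡2l+2l : ∀ l → l ℕ.* 4 ≡ 2 ℕ.* l ℕ.+ 2 ℕ.* l
      l4≡2l+2l = ℕSolver.solve-∀

    offset<C : ∀ {i} → P i ℤ.≤ + (l ℕ.* (k ℕ.+ 2)) - + 2 → i ℕ.< C
    offset<C {i} Pi≤ = ℕP.+-cancelˡ-≤ p (suc i) C
      (subst (ℕ._≤ p ℕ.+ C) (sym (ℕP.+-suc p i)) (≤-2⇒≤ l[k+2]≡2+[p+C] (subst (ℤ._≤ _) (P≡+ i) Pi≤)))

    height≤ : ∀ {n} → + n ℤ.≤ + (l ℕ.* (k ℕ.+ 4)) - + 2 → n ℕ.≤ p ℕ.+ C ℕ.+ C
    height≤ = ≤-2⇒≤ l[k+4]≡2+[p+C+C]

    w′≡w-below-reach : ∀ {n i} → i ℕ.< C → + n ℤ.≤ P i + c - + 2 → w′ n (P i) ≡ w n (P i)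
    w′≡w-below-reach {n} {i} i<C n≤Pi+c-2 = begin
      w′ n (P i)                    ≡⟨ strip-identity n n≤p+C+C i i<C ⟩
      w n (P i) ℕ.+ w n (P i + c)   ≡⟨ cong (w n (P i) ℕ.+_) (P+c-out-of-reach i n<) ⟩
      w n (P i) ℕ.+ 0               ≡⟨ ℕP.+-identityʳ _ ⟩
      w n (P i)                     ∎
      where
      open ≡-Reasoning
      reach : suc p ℕ.+ (i ℕ.+ C) ≡ 2 ℕ.+ (p ℕ.+ (i ℕ.+ C₁))
      reach = cong suc (trans (cong (λ m → p ℕ.+ (i ℕ.+ m)) C≡1+C₁)
                              (trans (cong (p ℕ.+_) (ℕP.+-suc i C₁)) (ℕP.+-suc p (i ℕ.+ C₁))))
      n≤ : n ℕ.≤ p ℕ.+ (i ℕ.+ C₁)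
      n≤ = ≤-2⇒≤ reach (subst (λ x → + n ℤ.≤ x - + 2) (trans (P-+c i) (P≡+ (i ℕ.+ C))) n≤Pi+c-2)
      C₁≤C : C₁ ℕ.≤ C
      C₁≤C = ℕP.<⇒≤ C₁<C
      n< : n ℕ.< suc p ℕ.+ (i ℕ.+ C)
      n< = s≤s (ℕP.≤-trans n≤ (ℕP.+-monoʳ-≤ p (ℕP.+-monoʳ-≤ i C₁≤C)))
      n≤p+C+C : n ℕ.≤ p ℕ.+ C ℕ.+ C
      n≤p+C+C = ℕP.≤-trans n≤ (ℕP.≤-trans (ℕP.+-monoʳ-≤ p (ℕP.+-mono-≤ (ℕP.<⇒≤ i<C) C₁≤C))
                                          (ℕP.≤-reflexive (sym (ℕP.+-assoc p C C))))

lemma4p1 : (l k : ℕ) → 2 ℕ.≤ l → 1 ℕ.≤ k →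
    (M N : ℤ) → + 2 ∣ (M + N) →
    + (l ℕ.* k) - 1ℤ ℤ.≤ M → M ℤ.≤ + (l ℕ.* (k ℕ.+ 2)) - + 2 →
    (N ℤ.≤ M + + (2 ℕ.* l) - + 2 → Z' l k M N ≡ Z l k M N)
    × (M + + (2 ℕ.* l) ℤ.≤ N → N ℤ.≤ + (l ℕ.* (k ℕ.+ 4)) - + 2 →
       Z' l k M N ≡ Z l k M N ℕ.+ Z l k (M + + (2 ℕ.* l)) N)
lemma4p1 l k 2≤l 1≤k M -[1+ n ] _ _ _ = (λ _ → refl) , (λ _ _ → refl)
lemma4p1 l k 2≤l 1≤k M (+ n) _ a≤M M≤b-1 = part-i , part-ii
  where
  open Model l k
  open Strip 2≤l 1≤k
  i : ℕ
  i = ℤ.∣ M - a ∣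
  Pi≡M : P i ≡ M
  Pi≡M = P∣x-a∣≡x a≤M
  i<C : i ℕ.< C
  i<C = offset<C (subst (ℤ._≤ _) (sym Pi≡M) M≤b-1)
  part-i : + n ℤ.≤ M + c - + 2 → w′ n M ≡ w n M
  part-i n≤ = subst (λ x → w′ n x ≡ w n x) Pi≡M
                    (w′≡w-below-reach i<C (subst (λ x → + n ℤ.≤ x + c - + 2) (sym Pi≡M) n≤))
  part-ii : M + c ℤ.≤ + n → + n ℤ.≤ + (l ℕ.* (k ℕ.+ 4)) - + 2 → w′ n M ≡ w n M ℕ.+ w n (M + c)
  part-ii _ n≤ = subst (λ x → w′ n x ≡ w n x ℕ.+ w n (x + c)) Pi≡M (strip-identity n (height≤ n≤) i i<C)
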